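{- Let $\Upsilon$ be a set of positions with $\mathcal{M}_{\mathrm{cl}(\Upsilon)}\cong\mathcal{M}_{\mathrm{cl}(*)}$. Then: (1) every $\xi\in\mathrm{cl}(\Upsilon)$ has $o^-(\xi)\in\{\mathcal{N},\mathcal{P}\}$; (2) $1,\overline{1}\notin\mathrm{cl}(\Upsilon)$ while $*\in\mathrm{cl}(\Upsilon)$; (3) if $\xi\in\mathrm{cl}(\Upsilon)$ and $o^-(\xi)=\mathcal{N}$, then $o^-(\xi^L)=\mathcal{P}$ for every Left option $\xi^L$ of $\xi$ and $o^-(\xi^R)=\mathcal{P}$ for every Right option $\xi^R$ of $\xi$.
   Context: A position $\xi=\{\xi^L \mid \xi^R\}$ is given recursively by finite sets of Left and Right options; $\cdot$ denotes an empty set. $0=\{\cdot\mid\cdot\}$, $*=\{0\mid 0\}$, $1=\{0\mid\cdot\}$, $\overline{1}=\{\cdot\mid 0\}$. Disjunctive sum: $\alpha+\beta=\{\alpha^L+\beta,\alpha+\beta^L \mid \alpha^R+\beta,\alpha+\beta^R\}$. Under misère play a player unable to move on their turn wins; $o^-(\xi)\in\{\mathcal{L},\mathcal{R},\mathcal{N},\mathcal{P}\}$ is the misère outcome (Left wins always / Right wins always / next player wins / next player loses). $\mathrm{cl}(\Upsilon)$ is the smallest set containing $\Upsilon$ closed under disjunctive sum and taking options. For closed $\Gamma$, $\alpha\equiv\beta\pmod\Gamma$ iff $o^-(\alpha+\gamma)=o^-(\beta+\gamma)$ for all $\gamma\in\Gamma$; the misère monoid $\mathcal{M}_\Gamma$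 is the quotient monoid (operation induced by $+$, identity the class of $0$) with each class labelled by its members' misère outcome. Isomorphism of misère monoids means a monoid isomorphism which with its inverse preserves outcomes. $\mathcal{M}_{\mathrm{cl}(*)}=\{1,a\}$, $a^2=1$, $1$ of outcome $\mathcal{N}$, $a$ of outcome $\mathcal{P}$. -}

module Defs where

open import Data.Bool using (Bool; true; false; not; _∨_; _xor_; if_then_else_)
open import Data.List using (List; []; _∷_; _++_)
open import Data.List.Membership.Propositional using (_∈_)
open import Data.Product using (_×_; ∃; Σ)
open import Relation.Binary.PropositionalEquality using (_≡_)
open import Function.Bundles using (_⇔_)

-- A position { ξ^L | ξ^R } : finite collections (lists) of Left and Right options.
-- Lists may repeat / reorder options; positions *as sets* are recovered via
-- the identity relation _≅_ below.
data Game : Set where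
  ⟨_∣_⟩ : List Game → List Game → Game

leftOpts : Game → List Game
leftOpts ⟨ L ∣ R ⟩ = L

rightOpts : Game → List Game
rightOpts ⟨ L ∣ R ⟩ = R

data _≅_ : Game → Game → Set where
  ident : ∀ {L R L′ R′} →
    (∀ {x} → x ∈ L  → ∃ λ y → y ∈ L′ × x ≅ y) →
    (∀ {y} → y ∈ L′ → ∃ λ x → x ∈ L  × x ≅ y) →
    (∀ {x} → x ∈ R  → ∃ λ y → y ∈ R′ × x ≅ y) →
    (∀ {y} → y ∈ R′ → ∃ λ x → x ∈ R  × x ≅ y) →
    ⟨ L ∣ R ⟩ ≅ ⟨ L′ ∣ R′ ⟩

𝟎 : Game
𝟎 = ⟨ [] ∣ [] ⟩

star : Game
star = ⟨ 𝟎 ∷ [] ∣ 𝟎 ∷ [] ⟩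

one : Game
one = ⟨ 𝟎 ∷ [] ∣ [] ⟩

oneBar : Game
oneBar = ⟨ [] ∣ 𝟎 ∷ [] ⟩

mutual
  _+_ : Game → Game → Game
  ⟨ L ∣ R ⟩ + ⟨ L′ ∣ R′ ⟩ =
    ⟨ addʳ L ⟨ L′ ∣ R′ ⟩ ++ addˡ ⟨ L ∣ R ⟩ L′
    ∣ addʳ R ⟨ L′ ∣ R′ ⟩ ++ addˡ ⟨ L ∣ R ⟩ R′ ⟩

  addʳ : List Game → Game → List Game
  addʳ [] h = []
  addʳ (g ∷ gs) h = (g + h) ∷ addʳ gs h

  addˡ : Game → List Game → List Game
  addˡ h [] = []
  addˡ h (g ∷ gs) = (h + g) ∷ addˡ h gs

infixl 6 _+_

-- Misère play: a player unable to move on their turn wins.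
-- leftFirst ξ  : Left, moving first on ξ, wins.
-- rightFirst ξ : Right, moving first on ξ, wins.
mutual
  leftFirst : Game → Bool
  leftFirst ⟨ [] ∣ R ⟩ = true
  leftFirst ⟨ g ∷ L ∣ R ⟩ = goodL (g ∷ L)

  rightFirst : Game → Bool
  rightFirst ⟨ L ∣ [] ⟩ = true
  rightFirst ⟨ L ∣ g ∷ R ⟩ = goodR (g ∷ R)

  goodL : List Game → Bool
  goodL [] = false
  goodL (g ∷ gs) = not (rightFirst g) ∨ goodL gs

  goodR : List Game → Bool
  goodR [] = false
  goodR (g ∷ gs) = not (leftFirst g) ∨ goodR gs

data Outcome : Set where
  𝓛 𝓡 𝓝 𝓟 : Outcome

outcomeOf : Bool → Bool → Outcome
outcomeOf true  true  = 𝓝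
outcomeOf true  false = 𝓛
outcomeOf false true  = 𝓡
outcomeOf false false = 𝓟

o⁻ : Game → Outcome
o⁻ ξ = outcomeOf (leftFirst ξ) (rightFirst ξ)

data Cl (Υ : Game → Set) : Game → Set where
  base : ∀ {ξ} → Υ ξ → Cl Υ ξ
  sum  : ∀ {α β} → Cl Υ α → Cl Υ β → Cl Υ (α + β)
  optL : ∀ {ξ ξL} → Cl Υ ξ → ξL ∈ leftOpts ξ → Cl Υ ξL
  optR : ∀ {ξ ξR} → Cl Υ ξ → ξR ∈ rightOpts ξ → Cl Υ ξR
  ident : ∀ {ξ η} → Cl Υ ξ → ξ ≅ η → Cl Υ η

_≡[mod_]_ : Game → (Game → Set) → Game → Set
α ≡[mod Γ ] β = ∀ γ → Γ γ → o⁻ (α + γ) ≡ o⁻ (β + γ)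

-- The misère monoid M_{cl(*)} = {1, a}: carrier Bool (false = 1, true = a),
-- operation xor, identity false, labels 1 ↦ 𝓝, a ↦ 𝓟.
labelCl* : Bool → Outcome
labelCl* b = if b then 𝓟 else 𝓝

-- An isomorphism of misère monoids M_Γ ≅ M_{cl(*)}, presented (there being no
-- quotient types) as a map φ on the members of Γ which induces a bijection
-- from the quotient Γ/≡(mod Γ) onto {1,a} that is a monoid homomorphism and
-- preserves outcome labels in both directions.
record MisereIsoCl* (Γ : Game → Set) : Set where
  field
    φ        : Game → Bool
    classes  : ∀ {α β} → Γ α → Γ β → (φ α ≡ φ β) ⇔ (α ≡[mod Γ ] β)
    surj     : ∀ b → ∃ λ α → Γ α × φ α ≡ b
    unit     : φ 𝟎 ≡ false
    hom      : ∀ {α β} → Γ α → Γ β → φ (α + β) ≡ (φ α xor φ β)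
    outcomes : ∀ {α} → Γ α → o⁻ α ≡ labelCl* (φ α)

module Submission where

-- Let φ be the given isomorphism M_cl(Υ) ≅ {1,a}.
--  (1) Every ξ ∈ cl(Υ) carries the label of φ ξ, which is 𝓝 or 𝓟.
--  (2) Hence 1 (outcome 𝓡) and 1̄ (outcome 𝓛) lie outside cl(Υ).  For *,
--      pick α with φ α = a.  A descent through the options shows that in any
--      closure omitting 1 and 1̄, every position is either 0 or forces
--      * into the closure: if no option forces *, all options are 0, so the
--      position is identical to 0, *, 1 or 1̄.  Since φ 0 = 1 ≠ a, α ≠ 0.
--  (3) If o⁻(ξ) = 𝓝 then φ ξ = 1, so φ(ξ + *) = a and ξ + * is a
--      𝓟-position.  Were some Left option ξᴸ an 𝓝-position, ξᴸ + * would be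
--      a 𝓟-position too, and Left would win ξ + * moving first by moving
--      to it — a contradiction; symmetrically for Right.

open import Defs
open import Data.Bool using (true; false; _xor_)
open import Data.Bool.Properties using (∨-zeroʳ)
open import Data.List using (List; []; _∷_)
open import Data.List.Membership.Propositional using (_∈_)
open import Data.List.Membership.Propositional.Properties using (∈-++⁺ˡ)
open import Data.List.Relation.Unary.Any using (here; there)
open import Data.List.Relation.Unary.All using (All; []; _∷_; lookup)
open import Data.Product using (_×_; _,_; ∃; proj₁; proj₂)
open import Data.Sum using (_⊎_; inj₁; inj₂; map)
open import Data.Empty using (⊥; ⊥-elim)
open import Relation.Binary.PropositionalEquality
  using (_≡_; refl; sym; trans; cong; cong₂)
open import Relation.Nullary using (¬_)

outcomeOf-𝓟 : ∀ a b → outcomeOf a b ≡ 𝓟 → a ≡ false × b ≡ false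
outcomeOf-𝓟 false false _ = refl , refl
outcomeOf-𝓟 true  true  ()
outcomeOf-𝓟 true  false ()
outcomeOf-𝓟 false true  ()

𝓟-loses : ∀ ξ → o⁻ ξ ≡ 𝓟 → leftFirst ξ ≡ false × rightFirst ξ ≡ false
𝓟-loses ξ = outcomeOf-𝓟 (leftFirst ξ) (rightFirst ξ)

bool-clash : ∀ {b} → b ≡ true → b ≡ false → ⊥
bool-clash refl ()

goodL-∈ : ∀ {x gs} → x ∈ gs → rightFirst x ≡ false → goodL gs ≡ true
goodL-∈ (here refl) lost rewrite lost = refl
goodL-∈ {gs = g ∷ _} (there x∈gs) lost rewrite goodL-∈ x∈gs lost = ∨-zeroʳ _

goodR-∈ : ∀ {x gs} → x ∈ gs → leftFirst x ≡ false → goodR gs ≡ true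
goodR-∈ (here refl) lost rewrite lost = refl
goodR-∈ {gs = g ∷ _} (there x∈gs) lost rewrite goodR-∈ x∈gs lost = ∨-zeroʳ _

leftFirst-wins : ∀ {x} ξ → x ∈ leftOpts ξ → rightFirst x ≡ false →
                 leftFirst ξ ≡ true
leftFirst-wins ⟨ _ ∷ _ ∣ _ ⟩ = goodL-∈

rightFirst-wins : ∀ {x} ξ → x ∈ rightOpts ξ → leftFirst x ≡ false →
                  rightFirst ξ ≡ true
rightFirst-wins ⟨ _ ∣ _ ∷ _ ⟩ = goodR-∈

addʳ-∈ : ∀ {x gs} h → x ∈ gs → (x + h) ∈ addʳ gs h
addʳ-∈ h (here refl)  = here refl
addʳ-∈ h (there x∈gs) = there (addʳ-∈ h x∈gs)

leftOpt-+ : ∀ {x} ξ γ → x ∈ leftOpts ξ → (x + γ) ∈ leftOpts (ξ + γ)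
leftOpt-+ ⟨ _ ∣ _ ⟩ γ@(⟨ _ ∣ _ ⟩) x∈L = ∈-++⁺ˡ (addʳ-∈ γ x∈L)

rightOpt-+ : ∀ {x} ξ γ → x ∈ rightOpts ξ → (x + γ) ∈ rightOpts (ξ + γ)
rightOpt-+ ⟨ _ ∣ _ ⟩ γ@(⟨ _ ∣ _ ⟩) x∈R = ∈-++⁺ˡ (addʳ-∈ γ x∈R)

-- An option list consisting only of 0s is, as a set, [0] or [] according
-- as it is non-empty or empty.
collapse : List Game → List Game
collapse []      = []
collapse (_ ∷ _) = 𝟎 ∷ []

𝟎≅𝟎 : 𝟎 ≅ 𝟎
𝟎≅𝟎 = ident (λ ()) (λ ()) (λ ()) (λ ())

zeros⊆collapse : ∀ {gs} → All (_≡ 𝟎) gs →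
                 ∀ {x} → x ∈ gs → ∃ λ y → y ∈ collapse gs × x ≅ y
zeros⊆collapse {_ ∷ _} zeros x∈gs with lookup zeros x∈gs
... | refl = 𝟎 , here refl , 𝟎≅𝟎

collapse⊆zeros : ∀ {gs} → All (_≡ 𝟎) gs →
                 ∀ {y} → y ∈ collapse gs → ∃ λ x → x ∈ gs × x ≅ y
collapse⊆zeros (refl ∷ _) (here refl) = 𝟎 , here refl , 𝟎≅𝟎

collapse-≅ : ∀ {L R} → All (_≡ 𝟎) L → All (_≡ 𝟎) R →
             ⟨ L ∣ R ⟩ ≅ ⟨ collapse L ∣ collapse R ⟩
collapse-≅ zL zR =
  ident (zeros⊆collapse zL) (collapse⊆zeros zL)
        (zeros⊆collapse zR) (collapse⊆zeros zR)

module Descent (Υ : Game → Set) (no-one : ¬ Cl Υ one) (no-oneBar : ¬ Cl Υ oneBar) where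

  collapsed : ∀ L R → Cl Υ ⟨ collapse L ∣ collapse R ⟩ →
              ⟨ L ∣ R ⟩ ≡ 𝟎 ⊎ Cl Υ star
  collapsed []      []      _ = inj₁ refl
  collapsed (_ ∷ _) (_ ∷ _) c = inj₂ c
  collapsed (_ ∷ _) []      c = ⊥-elim (no-one c)
  collapsed []      (_ ∷ _) c = ⊥-elim (no-oneBar c)

  mutual
    zero-or-star : ∀ ξ → Cl Υ ξ → ξ ≡ 𝟎 ⊎ Cl Υ star
    zero-or-star ⟨ L ∣ R ⟩ c
      with zeros-or-star L (optL c) | zeros-or-star R (optR c)
    ... | inj₂ s  | _       = inj₂ s
    ... | inj₁ _  | inj₂ s  = inj₂ s
    ... | inj₁ zL | inj₁ zR = collapsed L R (ident c (collapse-≅ zL zR))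

    zeros-or-star : ∀ gs → (∀ {x} → x ∈ gs → Cl Υ x) → All (_≡ 𝟎) gs ⊎ Cl Υ star
    zeros-or-star []       _  = inj₁ []
    zeros-or-star (g ∷ gs) cl
      with zero-or-star g (cl (here refl)) | zeros-or-star gs (λ x∈gs → cl (there x∈gs))
    ... | inj₂ s    | _        = inj₂ s
    ... | inj₁ _    | inj₂ s   = inj₂ s
    ... | inj₁ g≡𝟎  | inj₁ gs𝟎 = inj₁ (g≡𝟎 ∷ gs𝟎)

labelCl*-𝓝⊎𝓟 : ∀ b → labelCl* b ≡ 𝓝 ⊎ labelCl* b ≡ 𝓟
labelCl*-𝓝⊎𝓟 false = inj₁ refl
labelCl*-𝓝⊎𝓟 true  = inj₂ refl

labelCl*-𝓝 : ∀ {b} → labelCl* b ≡ 𝓝 → b ≡ false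
labelCl*-𝓝 {false} _ = refl
labelCl*-𝓝 {true}  ()

labelCl*-𝓟 : ∀ {b} → labelCl* b ≡ 𝓟 → b ≡ true
labelCl*-𝓟 {true}  _ = refl
labelCl*-𝓟 {false} ()

module UnderIsomorphism (Υ : Game → Set) (iso : MisereIsoCl* (Cl Υ)) where
  open MisereIsoCl* iso

  outcome-𝓝⊎𝓟 : (ξ : Game) → Cl Υ ξ → (o⁻ ξ ≡ 𝓝) ⊎ (o⁻ ξ ≡ 𝓟)
  outcome-𝓝⊎𝓟 ξ c =
    map (trans (outcomes c)) (trans (outcomes c)) (labelCl*-𝓝⊎𝓟 (φ ξ))

  -- o⁻(1) = 𝓡 and o⁻(1̄) = 𝓛.
  no-one : ¬ Cl Υ one
  no-one c with outcome-𝓝⊎𝓟 one c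
  ... | inj₁ ()
  ... | inj₂ ()

  no-oneBar : ¬ Cl Υ oneBar
  no-oneBar c with outcome-𝓝⊎𝓟 oneBar c
  ... | inj₁ ()
  ... | inj₂ ()

  open Descent Υ no-one no-oneBar

  -- A preimage of a is not 0 (as φ 0 = 1), so the descent yields *.
  star-∈ : Cl Υ star
  star-∈ with surj true
  ... | α , c , φα≡a with zero-or-star α c
  ... | inj₂ s    = s
  ... | inj₁ refl with trans (sym unit) φα≡a
  ... | ()

  φ-star : φ star ≡ true
  φ-star = labelCl*-𝓟 (sym (outcomes star-∈))

  𝓝+star-𝓟 : ∀ {ξ} → Cl Υ ξ → o⁻ ξ ≡ 𝓝 → o⁻ (ξ + star) ≡ 𝓟
  𝓝+star-𝓟 c ξ𝓝 = trans (outcomes c+*) (cong labelCl* φ[ξ+*]≡a)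
    where
    c+* = sum c star-∈
    φ[ξ+*]≡a : φ (_ + star) ≡ true
    φ[ξ+*]≡a = trans (hom c star-∈)
                     (cong₂ _xor_ (labelCl*-𝓝 (trans (sym (outcomes c)) ξ𝓝)) φ-star)

  -- Left moving first would win ξ + * by moving to the 𝓟-position ξᴸ + *.
  left-options-𝓟 : ∀ {ξ} → Cl Υ ξ → o⁻ ξ ≡ 𝓝 →
                   (ξL : Game) → ξL ∈ leftOpts ξ → o⁻ ξL ≡ 𝓟
  left-options-𝓟 {ξ} c ξ𝓝 ξL ξL∈ with outcome-𝓝⊎𝓟 ξL (optL c ξL∈)
  ... | inj₂ ξL𝓟 = ξL𝓟
  ... | inj₁ ξL𝓝 = ⊥-elim (bool-clash wins loses)
    where
    wins : leftFirst (ξ + star) ≡ true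
    wins = leftFirst-wins (ξ + star) (leftOpt-+ ξ star ξL∈)
             (proj₂ (𝓟-loses (ξL + star) (𝓝+star-𝓟 (optL c ξL∈) ξL𝓝)))
    loses : leftFirst (ξ + star) ≡ false
    loses = proj₁ (𝓟-loses (ξ + star) (𝓝+star-𝓟 c ξ𝓝))

  -- Right moving first would win ξ + * by moving to the 𝓟-position ξᴿ + *.
  right-options-𝓟 : ∀ {ξ} → Cl Υ ξ → o⁻ ξ ≡ 𝓝 →
                    (ξR : Game) → ξR ∈ rightOpts ξ → o⁻ ξR ≡ 𝓟
  right-options-𝓟 {ξ} c ξ𝓝 ξR ξR∈ with outcome-𝓝⊎𝓟 ξR (optR c ξR∈)
  ... | inj₂ ξR𝓟 = ξR𝓟
  ... | inj₁ ξR𝓝 = ⊥-elim (bool-clash wins loses)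
    where
    wins : rightFirst (ξ + star) ≡ true
    wins = rightFirst-wins (ξ + star) (rightOpt-+ ξ star ξR∈)
             (proj₁ (𝓟-loses (ξR + star) (𝓝+star-𝓟 (optR c ξR∈) ξR𝓝)))
    loses : rightFirst (ξ + star) ≡ false
    loses = proj₂ (𝓟-loses (ξ + star) (𝓝+star-𝓟 c ξ𝓝))

proposition7p3p2 : (Υ : Game → Set) → MisereIsoCl* (Cl Υ) →
    ((ξ : Game) → Cl Υ ξ → (o⁻ ξ ≡ 𝓝) ⊎ (o⁻ ξ ≡ 𝓟))
    × ((¬ Cl Υ one) × (¬ Cl Υ oneBar) × Cl Υ star)
    × ((ξ : Game) → Cl Υ ξ → o⁻ ξ ≡ 𝓝 →
        ((ξL : Game) → ξL ∈ leftOpts ξ → o⁻ ξL ≡ 𝓟)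
        × ((ξR : Game) → ξR ∈ rightOpts ξ → o⁻ ξR ≡ 𝓟))
proposition7p3p2 Υ iso =
  outcome-𝓝⊎𝓟 ,
  (no-one , no-oneBar , star-∈) ,
  (λ ξ c ξ𝓝 → left-options-𝓟 c ξ𝓝 , right-options-𝓟 c ξ𝓝)
  where open UnderIsomorphism Υ iso
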